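{- Assume $G$ satisfies the Plausibility Assumption. Let $S$ be a set of variables with $|S|\le\zeta\cdot\mathrm{SMALL}$. Then $\mathrm{cl}(S\cup\mathrm{vbls}(\mathrm{cl}(S)))=\mathrm{cl}(S)$.
   Context: Fix integers $K\ge3$, $3\le\tau\le K$. $G$ is a bipartite factor graph between $n$ variable-vertices and constraint-vertices, each constraint-vertex having between $\tau-1$ and $K$ neighbours. A subgraph is an edge-induced subgraph $H=G[A]$ (possibly empty, not necessarily connected); $\mathrm{vbls}(H),\mathrm{cons}(H)$ are its variable-/constraint-vertices, $N_H(f)$ the variables adjacent to $f$ in $H$. $H$ is a $\tau$-subgraph if $|N_H(f)|\ge\tau$ for all $f\in\mathrm{cons}(H)$; a leaf is a variable-vertex of degree $1$ in $H$. Parameters $1\le\mathrm{SMALL}\le n/2$, $0<\zeta<1$, $K\le\zeta\cdot\mathrm{SMALL}$; $H$ is small if $|\mathrm{cons}(H)|\le\mathrm{SMALL}$. For a $\tau$-subgraph $H$: credits $=$ number of leaves; debits $=\sum_{i}\max(\deg_H(i)-2,0)+\sum_{f}(|N_H(f)|-\tau)$; revenue $R(H)=$ credits $-$ debits; income $I(H)=R(H)-\zeta|\mathrm{cons}(H)|$; plausible means $I(H)\ge0$. Plausibility Assumption: every $\tau$-subgraph with at most $2\cdot\mathrm{SMALL}$ constraint-vertices is plausible. For a set $S$ of variables, $H$ is $S$-closed if it is a $\tau$-subgraph all of whose leaves lie in $S$; the closure $\mathrm{cl}(S)$ is the union of all small $S$-closed $\tau$-subgraphs.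
   Formalization: The parameter ζ ranges over the rationals. -}

module Defs where

open import Data.Nat as ℕ using (ℕ; zero; suc; _+_; _∸_; _≤_; _*_)
open import Data.Integer as ℤ using (ℤ; +_)
open import Data.Rational as ℚ using (ℚ; 0ℚ)
open import Data.Fin using (Fin; zero; suc)
open import Data.Fin.Subset using (Subset; _∈_; ∣_∣)
open import Data.Bool using (Bool; true; false; if_then_else_; T)
open import Data.Product using (Σ; ∃; _×_; _,_)
open import Data.Sum using (_⊎_)
open import Relation.Binary.PropositionalEquality using (_≡_)

sumFin : {k : ℕ} → (Fin k → ℕ) → ℕ
sumFin {zero}  f = 0
sumFin {suc k} f = f zero + sumFin (λ i → f (suc i))

count : {k : ℕ} → (Fin k → Bool) → ℕ
count p = sumFin (λ i → if p i then 1 else 0)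

-- A bipartite factor graph on variable-vertices Fin n and constraint-vertices
-- Fin m is given by its edge relation (edge i f = true iff variable i is
-- adjacent to constraint f).  An edge set of the same shape describes a
-- subgraph; the edge-induced subgraph G[A] has exactly the vertices incident
-- to edges of A.
EdgeSet : ℕ → ℕ → Set
EdgeSet n m = Fin n → Fin m → Bool

module _ {n m : ℕ} where

  _⊆E_ : EdgeSet n m → EdgeSet n m → Set
  A ⊆E G = ∀ i f → T (A i f) → T (G i f)

  nbrs : EdgeSet n m → Fin m → ℕ
  nbrs H f = count (λ i → H i f)

  deg : EdgeSet n m → Fin n → ℕ
  deg H i = count (λ f → H i f)

  isCon : EdgeSet n m → Fin m → Bool
  isCon H f with nbrs H f
  ... | zero  = false
  ... | suc _ = true

  numCons : EdgeSet n m → ℕ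
  numCons H = count (isCon H)

  InVbls : EdgeSet n m → Fin n → Set
  InVbls H i = ∃ λ f → T (H i f)

  IsTauSub : ℕ → EdgeSet n m → Set
  IsTauSub τ H = ∀ f → T (isCon H f) → τ ≤ nbrs H f

  IsLeaf : EdgeSet n m → Fin n → Set
  IsLeaf H i = deg H i ≡ 1

  isLeafB : EdgeSet n m → Fin n → Bool
  isLeafB H i with deg H i
  ... | suc zero = true
  ... | _        = false

  credits : EdgeSet n m → ℕ
  credits H = count (isLeafB H)

  -- Σ_i max(deg_H(i) - 2, 0) + Σ_{f ∈ cons(H)} (|N_H(f)| - τ)
  -- (for a τ-subgraph the second summand is exact; f ∉ cons(H) contributes 0)
  debits : ℕ → EdgeSet n m → ℕ
  debits τ H = sumFin (λ i → deg H i ∸ 2) + sumFin (λ f → nbrs H f ∸ τ)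

  revenue : ℕ → EdgeSet n m → ℤ
  revenue τ H = (+ credits H) ℤ.- (+ debits τ H)

  income : ℕ → ℚ → EdgeSet n m → ℚ
  income τ ζ H = (revenue τ H ℚ./ 1) ℚ.- (ζ ℚ.* ((+ numCons H) ℚ./ 1))

  Plausible : ℕ → ℚ → EdgeSet n m → Set
  Plausible τ ζ H = 0ℚ ℚ.≤ income τ ζ H

  PlausibilityAssumption : EdgeSet n m → ℕ → ℚ → ℕ → Set
  PlausibilityAssumption G τ ζ SMALL =
    ∀ H → H ⊆E G → IsTauSub τ H → numCons H ≤ 2 * SMALL → Plausible τ ζ H

  IsClosed : ℕ → (Fin n → Set) → EdgeSet n m → Set
  IsClosed τ P H = IsTauSub τ H × (∀ i → IsLeaf H i → P i)

  -- edge membership in cl(P): the union of all small P-closed τ-subgraphs of G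
  InCl : EdgeSet n m → ℕ → ℕ → (Fin n → Set) → Fin n → Fin m → Set
  InCl G τ SMALL P i f =
    Σ (EdgeSet n m) λ H → H ⊆E G × IsClosed τ P H × numCons H ≤ SMALL × T (H i f)

  ExtendByCl : EdgeSet n m → ℕ → ℕ → (Fin n → Set) → Fin n → Set
  ExtendByCl G τ SMALL P i = P i ⊎ (∃ λ f → InCl G τ SMALL P i f)

-- Closures are idempotent because the plausibility assumption makes S-closed
-- τ-subgraphs "self-shrinking": such a subgraph U with at most 2·SMALL
-- constraints satisfies ζ·|cons U| ≤ credits U ≤ |S| ≤ ζ·SMALL, so it is in
-- fact small.  Given a small subgraph H whose leaves lie in S ∪ vbls(cl S),
-- pick for every leaf outside S a small S-closed subgraph containing it; their
-- union U is again small and S-closed, and H ∪ U is an S-closed τ-subgraph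
-- with at most 2·SMALL constraints, hence small, so H ⊆ cl S.
module Submission where

open import Defs
open import Data.Nat using (ℕ; _≤_; _*_; _∸_; _+_)
open import Data.Integer using (+_)
open import Data.Rational using (ℚ; 0ℚ; 1ℚ; _<_; _/_)
open import Data.Fin using (Fin)
open import Data.Fin.Subset using (Subset; _∈_; ∣_∣)
open import Data.Bool using (T)
open import Data.Product using (_×_)
open import Function.Bundles using (_⇔_)

open import Data.Bool using (Bool; true; false; _∨_; if_then_else_)
open import Data.Bool.Properties using (T-∨)
open import Data.Empty using (⊥-elim)
open import Data.Fin using (zero; suc)
open import Data.Fin.Subset.Properties using (drop-there)
import Data.Integer as ℤ
import Data.Integer.Properties as ℤP
open import Data.Nat using (zero; suc; z≤n; s≤s)
import Data.Nat.Properties as ℕP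
open import Algebra.Properties.CommutativeSemigroup ℕP.+-commutativeSemigroup using (interchange)
import Data.Rational as ℚ
import Data.Rational.Properties as ℚP
import Data.Rational.Unnormalised as ℚᵘ
import Data.Rational.Unnormalised.Properties as ℚᵘP
open import Data.Product using (Σ; ∃; _,_; proj₁; proj₂)
open import Data.Sum using (_⊎_; inj₁; inj₂; [_,_]) renaming (map to ⊎-map)
open import Data.Unit using (tt)
open import Data.Vec using ([]; _∷_)
open import Function using (_∘_)
open import Function.Bundles using (mk⇔; Equivalence)
open import Relation.Binary.PropositionalEquality using (_≡_; refl; sym; subst; cong)
open import Relation.Nullary using (yes; no)

0≤p-q⇒q≤p : ∀ p q → 0ℚ ℚ.≤ p ℚ.- q → q ℚ.≤ p
0≤p-q⇒q≤p p q 0≤p-q = begin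
  q                    ≡⟨ ℚP.+-identityˡ q ⟨
  0ℚ ℚ.+ q             ≤⟨ ℚP.+-monoˡ-≤ q 0≤p-q ⟩
  (p ℚ.- q) ℚ.+ q      ≡⟨ ℚP.+-assoc p (ℚ.- q) q ⟩
  p ℚ.+ (ℚ.- q ℚ.+ q)  ≡⟨ cong (p ℚ.+_) (ℚP.+-inverseˡ q) ⟩
  p ℚ.+ 0ℚ             ≡⟨ ℚP.+-identityʳ p ⟩
  p                    ∎
  where open ℚP.≤-Reasoning

-- i / 1 normalises through gcd i 1, so it is compared with i via toℚᵘ.
/1-≃ : ∀ i → ℚ.toℚᵘ (i / 1) ℚᵘ.≃ ℚᵘ.mkℚᵘ i 0
/1-≃ i = ℚP.toℚᵘ-fromℚᵘ (ℚᵘ.mkℚᵘ i 0)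

/1-mono-≤ : ∀ {i j} → i ℤ.≤ j → i / 1 ℚ.≤ j / 1
/1-mono-≤ {i} {j} i≤j = ℚP.toℚᵘ-cancel-≤
  (ℚᵘP.≤-respˡ-≃ (ℚᵘP.≃-sym (/1-≃ i)) (ℚᵘP.≤-respʳ-≃ (ℚᵘP.≃-sym (/1-≃ j))
    (ℚᵘ.*≤* (ℤP.*-monoʳ-≤-nonNeg (+ 1) i≤j))))

/1-cancel-≤ : ∀ {i j} → i / 1 ℚ.≤ j / 1 → i ℤ.≤ j
/1-cancel-≤ {i} {j} i≤j
  with ℚᵘP.≤-respˡ-≃ (/1-≃ i) (ℚᵘP.≤-respʳ-≃ (/1-≃ j) (ℚP.toℚᵘ-mono-≤ i≤j))
... | ℚᵘ.*≤* i*1≤j*1 = ℤP.*-cancelʳ-≤-pos i j (+ 1) i*1≤j*1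

count-mono : ∀ {k} (p q : Fin k → Bool) → (∀ i → T (p i) → T (q i)) → count p ≤ count q
count-mono {zero}  p q p⇒q = z≤n
count-mono {suc k} p q p⇒q =
  ℕP.+-mono-≤ (head (p zero) (q zero) (p⇒q zero)) (count-mono (p ∘ suc) (q ∘ suc) (p⇒q ∘ suc))
  where
  head : ∀ a b → (T a → T b) → (if a then 1 else 0) ≤ (if b then 1 else 0)
  head false b     _   = z≤n
  head true  true  _   = ℕP.≤-refl
  head true  false a⇒b = ⊥-elim (a⇒b tt)

count-∨ : ∀ {k} (p q : Fin k → Bool) → count (λ i → p i ∨ q i) ≤ count p + count q
count-∨ {zero}  p q = z≤n
count-∨ {suc k} p q = ℕP.≤-trans
  (ℕP.+-mono-≤ (head (p zero) (q zero)) (count-∨ (p ∘ suc) (q ∘ suc)))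
  (ℕP.≤-reflexive (interchange (if p zero then 1 else 0) (if q zero then 1 else 0) _ _))
  where
  head : ∀ a b → (if a ∨ b then 1 else 0) ≤ (if a then 1 else 0) + (if b then 1 else 0)
  head true  b = s≤s z≤n
  head false b = ℕP.≤-refl

T⇒1≤count : ∀ {k} (p : Fin k → Bool) i → T (p i) → 1 ≤ count p
T⇒1≤count p zero t with p zero
... | true = s≤s z≤n
T⇒1≤count p (suc i) t = ℕP.≤-trans (T⇒1≤count (p ∘ suc) i t) (ℕP.m≤n+m _ _)

1≤count⇒∃T : ∀ {k} (p : Fin k → Bool) → 1 ≤ count p → ∃ λ i → T (p i)
1≤count⇒∃T {suc k} p 1≤count with p zero in eq
... | true  = zero , subst T (sym eq) tt
... | false = let i , t = 1≤count⇒∃T (p ∘ suc) 1≤count in suc i , t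

count-false : ∀ {k} → count {k} (λ _ → false) ≡ 0
count-false {zero}  = refl
count-false {suc k} = count-false {k}

count≤∣∣ : ∀ {k} (p : Fin k → Bool) (S : Subset k) → (∀ i → T (p i) → i ∈ S) → count p ≤ ∣ S ∣
count≤∣∣ {zero}  p []          p⊆S = z≤n
count≤∣∣ {suc k} p (true ∷ S)  p⊆S =
  ℕP.+-mono-≤ (head (p zero)) (count≤∣∣ (p ∘ suc) S (λ i → drop-there ∘ p⊆S (suc i)))
  where
  head : ∀ a → (if a then 1 else 0) ≤ 1
  head true  = ℕP.≤-refl
  head false = z≤n
count≤∣∣ {suc k} p (false ∷ S) p⊆S with p zero in eq
... | true  with () ← p⊆S zero (subst T (sym eq) tt)
... | false = count≤∣∣ (p ∘ suc) S (λ i → drop-there ∘ p⊆S (suc i))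

module _ {n m : ℕ} where

  _∪E_ : EdgeSet n m → EdgeSet n m → EdgeSet n m
  (A ∪E B) i f = A i f ∨ B i f

  ∅E : EdgeSet n m
  ∅E _ _ = false

  ⋃ : ∀ {k} → (Fin k → EdgeSet n m) → EdgeSet n m
  ⋃ {zero}  Q = ∅E
  ⋃ {suc k} Q = Q zero ∪E ⋃ (Q ∘ suc)

  ∪E-⊆ˡ : ∀ (A B : EdgeSet n m) → A ⊆E (A ∪E B)
  ∪E-⊆ˡ A B i f = Equivalence.from T-∨ ∘ inj₁

  ∪E-⊆ʳ : ∀ (A B : EdgeSet n m) → B ⊆E (A ∪E B)
  ∪E-⊆ʳ A B i f = Equivalence.from T-∨ ∘ inj₂

  ∪E-split : ∀ (A B : EdgeSet n m) {i f} → T ((A ∪E B) i f) → T (A i f) ⊎ T (B i f)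
  ∪E-split A B = Equivalence.to T-∨

  ∪E-least : ∀ {A B C : EdgeSet n m} → A ⊆E C → B ⊆E C → (A ∪E B) ⊆E C
  ∪E-least {A} {B} A⊆C B⊆C i f e = [ A⊆C i f , B⊆C i f ] (∪E-split A B e)

  ⊆-⋃ : ∀ {k} (Q : Fin k → EdgeSet n m) j → Q j ⊆E ⋃ Q
  ⊆-⋃ Q zero    = ∪E-⊆ˡ (Q zero) (⋃ (Q ∘ suc))
  ⊆-⋃ Q (suc j) i f = ∪E-⊆ʳ (Q zero) (⋃ (Q ∘ suc)) i f ∘ ⊆-⋃ (Q ∘ suc) j i f

  ⋃-preserves : (Pr : EdgeSet n m → Set) → Pr ∅E → (∀ A B → Pr A → Pr B → Pr (A ∪E B)) →
                ∀ {k} (Q : Fin k → EdgeSet n m) → (∀ j → Pr (Q j)) → Pr (⋃ Q)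
  ⋃-preserves Pr Pr∅ Pr∪ {zero}  Q PrQ = Pr∅
  ⋃-preserves Pr Pr∅ Pr∪ {suc k} Q PrQ =
    Pr∪ (Q zero) (⋃ (Q ∘ suc)) (PrQ zero) (⋃-preserves Pr Pr∅ Pr∪ (Q ∘ suc) (PrQ ∘ suc))

  nbrs-mono : ∀ {A B : EdgeSet n m} → A ⊆E B → ∀ f → nbrs A f ≤ nbrs B f
  nbrs-mono A⊆B f = count-mono _ _ (λ i → A⊆B i f)

  deg-mono : ∀ {A B : EdgeSet n m} → A ⊆E B → ∀ i → deg A i ≤ deg B i
  deg-mono A⊆B i = count-mono _ _ (A⊆B i)

  InVbls-⊆ : ∀ {A B : EdgeSet n m} → A ⊆E B → ∀ {i} → InVbls A i → InVbls B i
  InVbls-⊆ A⊆B (f , e) = f , A⊆B _ f e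

  edge⇒isCon : ∀ (H : EdgeSet n m) i f → T (H i f) → T (isCon H f)
  edge⇒isCon H i f e = 1≤nbrs⇒isCon (T⇒1≤count (λ j → H j f) i e)
    where
    1≤nbrs⇒isCon : 1 ≤ nbrs H f → T (isCon H f)
    1≤nbrs⇒isCon 1≤nbrs with nbrs H f
    ... | suc _ = tt

  isCon⇒edge : ∀ (H : EdgeSet n m) f → T (isCon H f) → ∃ λ i → T (H i f)
  isCon⇒edge H f con = 1≤count⇒∃T (λ j → H j f) (isCon⇒1≤nbrs con)
    where
    isCon⇒1≤nbrs : T (isCon H f) → 1 ≤ nbrs H f
    isCon⇒1≤nbrs con with nbrs H f
    ... | suc _ = s≤s z≤n

  leaf⇒InVbls : ∀ (H : EdgeSet n m) {i} → IsLeaf H i → InVbls H i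
  leaf⇒InVbls H leaf = 1≤count⇒∃T _ (ℕP.≤-reflexive (sym leaf))

  leaf-⊆ : ∀ {A W : EdgeSet n m} → A ⊆E W → ∀ {i} → InVbls A i → IsLeaf W i → IsLeaf A i
  leaf-⊆ {A} A⊆W {i} (f , e) leaf =
    ℕP.≤-antisym (subst (deg A i ≤_) leaf (deg-mono A⊆W i)) (T⇒1≤count (A i) f e)

  leaf-∪E : ∀ (A B : EdgeSet n m) {i} → IsLeaf (A ∪E B) i → IsLeaf A i ⊎ IsLeaf B i
  leaf-∪E A B leaf with leaf⇒InVbls (A ∪E B) leaf
  ... | f , e with ∪E-split A B e
  ...   | inj₁ a = inj₁ (leaf-⊆ (∪E-⊆ˡ A B) (f , a) leaf)
  ...   | inj₂ b = inj₂ (leaf-⊆ (∪E-⊆ʳ A B) (f , b) leaf)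

  IsTauSub-∪E : ∀ {τ} (A B : EdgeSet n m) → IsTauSub τ A → IsTauSub τ B → IsTauSub τ (A ∪E B)
  IsTauSub-∪E A B τA τB f con with isCon⇒edge (A ∪E B) f con
  ... | i , e with ∪E-split A B e
  ...   | inj₁ a = ℕP.≤-trans (τA f (edge⇒isCon A i f a)) (nbrs-mono (∪E-⊆ˡ A B) f)
  ...   | inj₂ b = ℕP.≤-trans (τB f (edge⇒isCon B i f b)) (nbrs-mono (∪E-⊆ʳ A B) f)

  IsClosed-∪E : ∀ {τ P} (A B : EdgeSet n m) → IsClosed τ P A → IsClosed τ P B → IsClosed τ P (A ∪E B)
  IsClosed-∪E A B (τA , leavesA) (τB , leavesB) =
    IsTauSub-∪E A B τA τB , λ i → [ leavesA i , leavesB i ] ∘ leaf-∪E A B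

  IsClosed-∅E : ∀ {τ P} → IsClosed τ P ∅E
  IsClosed-∅E = (λ f con → ⊥-elim (proj₂ (isCon⇒edge ∅E f con))) ,
                (λ i leaf → ⊥-elim (proj₂ (leaf⇒InVbls ∅E {i} leaf)))

  numCons-∪E : ∀ (A B : EdgeSet n m) → numCons (A ∪E B) ≤ numCons A + numCons B
  numCons-∪E A B =
    ℕP.≤-trans (count-mono (isCon (A ∪E B)) (λ f → isCon A f ∨ isCon B f) con-∪E) (count-∨ (isCon A) (isCon B))
    where
    con-∪E : ∀ f → T (isCon (A ∪E B) f) → T (isCon A f ∨ isCon B f)
    con-∪E f con with isCon⇒edge (A ∪E B) f con
    ... | i , e = Equivalence.from T-∨ (⊎-map (edge⇒isCon A i f) (edge⇒isCon B i f) (∪E-split A B e))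

  numCons-∅E : numCons ∅E ≡ 0
  numCons-∅E = ℕP.n≤0⇒n≡0 (ℕP.≤-trans
    (count-mono (isCon ∅E) (λ _ → false) (λ f con → proj₂ (isCon⇒edge ∅E f con)))
    (ℕP.≤-reflexive (count-false {m})))

  credits≤∣∣ : ∀ {τ} (S : Subset n) (H : EdgeSet n m) → IsClosed τ (_∈ S) H → credits H ≤ ∣ S ∣
  credits≤∣∣ S H (_ , leaves) = count≤∣∣ (isLeafB H) S (λ i → leaves i ∘ isLeafB⇒IsLeaf i)
    where
    isLeafB⇒IsLeaf : ∀ i → T (isLeafB H i) → IsLeaf H i
    isLeafB⇒IsLeaf i t with deg H i
    ... | suc zero = refl

  plausible⇒ζcons≤credits : ∀ {τ ζ} (H : EdgeSet n m) → Plausible τ ζ H →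
                            ζ ℚ.* (+ numCons H / 1) ℚ.≤ + credits H / 1
  plausible⇒ζcons≤credits {τ} H plausible =
    ℚP.≤-trans (0≤p-q⇒q≤p _ _ plausible) (/1-mono-≤ revenue≤credits)
    where
    revenue≤credits : revenue τ H ℤ.≤ + credits H
    revenue≤credits = subst (ℤ._≤ + credits H) (sym (ℤP.m-n≡m⊖n (credits H) (debits τ H)))
                            (ℤP.m⊖n≤m (credits H) (debits τ H))

  InCl-mono : ∀ (G : EdgeSet n m) τ SMALL {P Q : Fin n → Set} → (∀ i → P i → Q i) →
              ∀ {i f} → InCl G τ SMALL P i f → InCl G τ SMALL Q i f
  InCl-mono G τ SMALL P⇒Q (H , H⊆G , (τH , leaves) , small , e) =
    H , H⊆G , (τH , λ i → P⇒Q i ∘ leaves i) , small , e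

module _ {n m : ℕ} (G : EdgeSet n m) (τ SMALL : ℕ) (ζ : ℚ) (S : Subset n)
         (plausibility : PlausibilityAssumption G τ ζ SMALL) (ζ>0 : 0ℚ < ζ)
         (∣S∣≤ζSMALL : + ∣ S ∣ / 1 ℚ.≤ ζ ℚ.* (+ SMALL / 1)) where

  closed-numCons-≤ : ∀ H → H ⊆E G → IsClosed τ (_∈ S) H → numCons H ≤ 2 * SMALL → numCons H ≤ SMALL
  closed-numCons-≤ H H⊆G closed cons≤2SMALL =
    ℤP.drop‿+≤+ (/1-cancel-≤ (ℚP.*-cancelˡ-≤-pos ζ {{ℚ.positive ζ>0}} (begin
      ζ ℚ.* (+ numCons H / 1)  ≤⟨ plausible⇒ζcons≤credits {τ = τ} {ζ} H plausibleH ⟩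
      + credits H / 1          ≤⟨ /1-mono-≤ (ℤ.+≤+ (credits≤∣∣ S H closed)) ⟩
      + ∣ S ∣ / 1              ≤⟨ ∣S∣≤ζSMALL ⟩
      ζ ℚ.* (+ SMALL / 1)      ∎)))
    where
    open ℚP.≤-Reasoning
    plausibleH : Plausible τ ζ H
    plausibleH = plausibility H H⊆G (proj₁ closed) cons≤2SMALL

  SmallClosed : EdgeSet n m → Set
  SmallClosed H = H ⊆E G × IsClosed τ (_∈ S) H × numCons H ≤ SMALL

  small+small≤2SMALL : ∀ {a b} → a ≤ SMALL → b ≤ SMALL → a + b ≤ 2 * SMALL
  small+small≤2SMALL a≤ b≤ = ℕP.+-mono-≤ a≤ (ℕP.≤-trans b≤ (ℕP.m≤m+n SMALL 0))

  SmallClosed-∪E : ∀ A B → SmallClosed A → SmallClosed B → SmallClosed (A ∪E B)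
  SmallClosed-∪E A B (A⊆G , closedA , smallA) (B⊆G , closedB , smallB) =
    A∪B⊆G , closedA∪B ,
    closed-numCons-≤ (A ∪E B) A∪B⊆G closedA∪B
      (ℕP.≤-trans (numCons-∪E A B) (small+small≤2SMALL smallA smallB))
    where
    A∪B⊆G = ∪E-least A⊆G B⊆G
    closedA∪B = IsClosed-∪E A B closedA closedB

  SmallClosed-∅E : SmallClosed ∅E
  SmallClosed-∅E = (λ _ _ ()) , IsClosed-∅E , subst (_≤ SMALL) (sym (numCons-∅E {n} {m})) z≤n

  cl-extended⇒cl : ∀ {i f} → InCl G τ SMALL (ExtendByCl G τ SMALL (_∈ S)) i f → InCl G τ SMALL (_∈ S) i f
  cl-extended⇒cl {i} {f} (H , H⊆G , (τH , leavesH) , smallH , e) =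
    W , W⊆G , closedW , closed-numCons-≤ W W⊆G closedW consW≤2SMALL , ∪E-⊆ˡ H U i f e
    where
    cover : ∀ j → Σ (EdgeSet n m) λ Q → SmallClosed Q × (IsLeaf H j → j ∈ S ⊎ InVbls Q j)
    cover j with deg H j ℕP.≟ 1
    ... | no ¬leaf = ∅E , SmallClosed-∅E , ⊥-elim ∘ ¬leaf
    ... | yes leaf with leavesH j leaf
    ...   | inj₁ j∈S = ∅E , SmallClosed-∅E , λ _ → inj₁ j∈S
    ...   | inj₂ (g , Q , Q⊆G , closedQ , smallQ , e) = Q , (Q⊆G , closedQ , smallQ) , λ _ → inj₂ (g , e)

    U : EdgeSet n m
    U = ⋃ (λ j → proj₁ (cover j))

    U-small : SmallClosed U
    U-small = ⋃-preserves SmallClosed SmallClosed-∅E SmallClosed-∪E _ (λ j → proj₁ (proj₂ (cover j)))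

    τU : IsTauSub τ U
    τU = proj₁ (proj₁ (proj₂ U-small))

    leavesU : ∀ j → IsLeaf U j → j ∈ S
    leavesU = proj₂ (proj₁ (proj₂ U-small))

    W : EdgeSet n m
    W = H ∪E U

    W⊆G : W ⊆E G
    W⊆G = ∪E-least H⊆G (proj₁ U-small)

    leavesW : ∀ j → IsLeaf W j → j ∈ S
    leavesW j leaf with leaf-∪E H U leaf
    ... | inj₂ leafU = leavesU j leafU
    ... | inj₁ leafH with proj₂ (proj₂ (cover j)) leafH
    ...   | inj₁ j∈S = j∈S
    ...   | inj₂ j∈Q = leavesU j (leaf-⊆ (∪E-⊆ʳ H U) (InVbls-⊆ (⊆-⋃ (λ j → proj₁ (cover j)) j) j∈Q) leaf)

    closedW : IsClosed τ (_∈ S) W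
    closedW = IsTauSub-∪E H U τH τU , leavesW

    consW≤2SMALL : numCons W ≤ 2 * SMALL
    consW≤2SMALL = ℕP.≤-trans (numCons-∪E H U) (small+small≤2SMALL smallH (proj₂ (proj₂ U-small)))

theorem5p9 : (K τ n m SMALL : ℕ) (ζ : ℚ) (G : EdgeSet n m) →
    3 ≤ K → 3 ≤ τ → τ ≤ K →
    (∀ f → (τ ∸ 1 ≤ nbrs G f) × (nbrs G f ≤ K)) →
    1 ≤ SMALL → 2 * SMALL ≤ n →
    0ℚ < ζ → ζ < 1ℚ → (+ K / 1) Data.Rational.≤ ζ Data.Rational.* (+ SMALL / 1) →
    PlausibilityAssumption G τ ζ SMALL →
    (S : Subset n) → (+ ∣ S ∣ / 1) Data.Rational.≤ ζ Data.Rational.* (+ SMALL / 1) →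
    ∀ i f → InCl G τ SMALL (ExtendByCl G τ SMALL (_∈ S)) i f ⇔ InCl G τ SMALL (_∈ S) i f
theorem5p9 K τ n m SMALL ζ G _ _ _ _ _ _ ζ>0 _ _ plausibility S ∣S∣≤ζSMALL i f =
  mk⇔ (cl-extended⇒cl G τ SMALL ζ S plausibility ζ>0 ∣S∣≤ζSMALL) (InCl-mono G τ SMALL (λ _ → inj₁))
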